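{- Let $n\geq 1$ and let $R_1,\ldots,R_n\subseteq\Omega$ be role sets such that $\overline{R_1}\uplus\cdots\uplus\overline{R_n}=\Omega$. Then the rule (mp-cut) is admissible in MRL: for every formula $A$ and all sequents $\Gamma_1,\ldots,\Gamma_n$, if $\vdash\Gamma_i,R_i\{A\}$ is derivable for each $1\leq i\leq n$, then $\vdash\Gamma_1,\ldots,\Gamma_n$ is derivable.
   Context: Fix a set $\Omega$ of roles (possibly infinite). A role set is a subset $R\subseteq\Omega$; $\overline{R}=\Omega\setminus R$; $R_1\uplus\cdots\uplus R_n=\Omega$ means the $R_i$ are pairwise disjoint with union $\Omega$. A filter on $\Omega$ is a family $\mathcal F$ of subsets of $\Omega$ with $\Omega\in\mathcal F$, closed upward under inclusion and under binary intersection; an ultrafilter is a filter containing $R$ or $\overline R$ for every $R\subseteq\Omega$. For an endomorphism $f:\Omega\to\Omega$, $f^{ -1}(R)=\{r\mid f(r)\in R\}$. Formulas of MRL (multirole logic), over standard first-order terms $t$ and variables $x$: $A,B::=a\mid\neg_f(A)\mid A\wedge_{\mathcal U}B\mid\forall_{\mathcal U}(\lambda x.A)$, where $a$ ranges over primitive formulas, $f$ over endomorphisms of $\Omega$, $\mathcal U$ over ultrafilters on $\Omega$; $A[x:=t]$ denotes substitution. An i-formula is $R\{A\}$ for a role set $R$ and formula $A$; a sequent $\Gamma$ is a finite multiset of i-formulas (comma = multiset union). Derivable sequents $\vdash\Gamma$ are generated by: (Id) $\vdash R_1\{a\},\ldots,R_n\{a\}$ whenever $R_1\uplus\cdots\uplus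 R_n=\Omega$; (Weaken) from $\Gamma$ infer $\Gamma,R\{A\}$; (Contract) from $\Gamma,R\{A\},R\{A\}$ infer $\Gamma,R\{A\}$; ($\neg$) from $\Gamma,f^{ -1}(R)\{A\}$ infer $\Gamma,R\{\neg_f(A)\}$; ($\wedge$-neg-l/r) if $R\notin\mathcal U$, from $\Gamma,R\{A\}$ (resp. $\Gamma,R\{B\}$) infer $\Gamma,R\{A\wedge_{\mathcal U}B\}$; ($\wedge$-pos) if $R\in\mathcal U$, from $\Gamma,R\{A\}$ and $\Gamma,R\{B\}$ infer $\Gamma,R\{A\wedge_{\mathcal U}B\}$; ($\forall$-neg) if $R\notin\mathcal U$, from $\Gamma,R\{A[x:=t]\}$ infer $\Gamma,R\{\forall_{\mathcal U}(\lambda x.A)\}$; ($\forall$-pos) if $R\in\mathcal U$ and $x$ is not free in $\Gamma$, from $\Gamma,R\{A\}$ infer $\Gamma,R\{\forall_{\mathcal U}(\lambda x.A)\}$. A rule is admissible if its conclusion is derivable whenever all its premisses are. -}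

module Defs where

open import Data.Nat using (ℕ; zero; suc)
open import Data.Bool using (Bool; true; false; not; _∧_)
open import Data.Fin using (Fin)
open import Data.Vec using (Vec; []; _∷_)
open import Data.List using (List; []; _∷_; _++_; tabulate)
open import Data.Product using (_×_; ∃)
open import Data.Sum using (_⊎_)
open import Relation.Nullary using (¬_)
open import Relation.Binary.PropositionalEquality using (_≡_)
open import Data.List.Relation.Binary.Permutation.Propositional using (_↭_)
open import Data.List.Relation.Binary.Pointwise using (Pointwise)

module MRL (Ω : Set) (Fun Rel : ℕ → Set) where

  RoleSet : Set
  RoleSet = Ω → Bool

  _∈ᵣ_ : Ω → RoleSet → Set
  r ∈ᵣ R = R r ≡ true

  ∁ : RoleSet → RoleSet
  ∁ R r = not (R r)

  _∩_ : RoleSet → RoleSet → RoleSet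
  (R ∩ S) r = R r ∧ S r

  _⊆_ : RoleSet → RoleSet → Set
  R ⊆ S = ∀ r → r ∈ᵣ R → r ∈ᵣ S

  ΩR : RoleSet
  ΩR _ = true

  _⁻¹[_] : (Ω → Ω) → RoleSet → RoleSet
  (f ⁻¹[ R ]) r = R (f r)

  DisjointUnion : ∀ {m} → (Fin m → RoleSet) → Set
  DisjointUnion {m} Rs =
    (∀ i j r → r ∈ᵣ Rs i → r ∈ᵣ Rs j → i ≡ j) × (∀ r → ∃ λ i → r ∈ᵣ Rs i)

  record IsFilter (mem : RoleSet → Set) : Set where
    field
      whole  : mem ΩR
      upward : ∀ {R S} → R ⊆ S → mem R → mem S
      inter  : ∀ {R S} → mem R → mem S → mem (R ∩ S)

  record Ultrafilter : Set₁ where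
    field
      _∋_      : RoleSet → Set
      isFilter : IsFilter _∋_
      ultra    : ∀ R → _∋_ R ⊎ _∋_ (∁ R)
  open Ultrafilter public using (_∋_)

  data Term : Set where
    var : ℕ → Term
    fun : ∀ {k} → Fun k → Vec Term k → Term

  Subst : Set
  Subst = ℕ → Term

  mutual
    substT : Subst → Term → Term
    substT σ (var x)    = σ x
    substT σ (fun g ts) = fun g (substTs σ ts)

    substTs : ∀ {k} → Subst → Vec Term k → Vec Term k
    substTs σ []       = []
    substTs σ (t ∷ ts) = substT σ t ∷ substTs σ ts

  ↑T : Term → Term
  ↑T = substT (λ x → var (suc x))

  exts : Subst → Subst
  exts σ zero    = var zero
  exts σ (suc x) = ↑T (σ x)

  -- MRL formulas:  A ::= a | ¬_f(A) | A ∧_U B | ∀_U(λx.A)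
  -- (the body of ∀ binds de Bruijn variable 0)
  data Formula : Set₁ where
    atom : ∀ {k} → Rel k → Vec Term k → Formula
    ¬[_]_ : (Ω → Ω) → Formula → Formula
    _∧[_]_ : Formula → Ultrafilter → Formula → Formula
    ∀[_]_ : Ultrafilter → Formula → Formula

  substF : Subst → Formula → Formula
  substF σ (atom p ts)   = atom p (substTs σ ts)
  substF σ (¬[ f ] A)    = ¬[ f ] substF σ A
  substF σ (A ∧[ U ] B)  = substF σ A ∧[ U ] substF σ B
  substF σ (∀[ U ] A)    = ∀[ U ] substF (exts σ) A

  -- A[x:=t] where x is the variable bound by ∀(λx.A)
  _[_] : Formula → Term → Formula
  A [ t ] = substF σ A
    where
    σ : Subst
    σ zero    = t
    σ (suc x) = var x

  data IFormula : Set₁ where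
    _⟨_⟩ : RoleSet → Formula → IFormula

  Sequent : Set₁
  Sequent = List IFormula

  _,,_ : Sequent → IFormula → Sequent
  Γ ,, φ = Γ ++ φ ∷ []
  infixl 5 _,,_

  ↑I : IFormula → IFormula
  ↑I (R ⟨ A ⟩) = R ⟨ substF (λ x → var (suc x)) A ⟩

  ↑S : Sequent → Sequent
  ↑S [] = []
  ↑S (φ ∷ Γ) = ↑I φ ∷ ↑S Γ

  -- Equality of formulas as mathematical objects: endomorphisms are
  -- compared pointwise, ultrafilters by their members.
  SameUF : Ultrafilter → Ultrafilter → Set
  SameUF U V = ∀ R → (U ∋ R → V ∋ R) × (V ∋ R → U ∋ R)

  data _≈F_ : Formula → Formula → Set₁ where
    atom : ∀ {k} {p : Rel k} {ts} → atom p ts ≈F atom p ts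
    neg  : ∀ {f g A B} → (∀ r → f r ≡ g r) → A ≈F B → (¬[ f ] A) ≈F (¬[ g ] B)
    conj : ∀ {U V A A′ B B′} → SameUF U V → A ≈F A′ → B ≈F B′ →
           (A ∧[ U ] B) ≈F (A′ ∧[ V ] B′)
    all  : ∀ {U V A B} → SameUF U V → A ≈F B → (∀[ U ] A) ≈F (∀[ V ] B)

  _≈I_ : IFormula → IFormula → Set₁
  (R ⟨ A ⟩) ≈I (S ⟨ B ⟩) = (∀ r → R r ≡ S r) × A ≈F B

  infix 4 ⊢_
  data ⊢_ : Sequent → Set₁ where
    -- sequents are multisets: closed under reordering ...
    exch : ∀ {Γ Δ} → Γ ↭ Δ → ⊢ Γ → ⊢ Δ
    -- ... and role sets / formulas are compared extensionally
    conv : ∀ {Γ Δ} → Pointwise _≈I_ Γ Δ → ⊢ Γ → ⊢ Δ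
    Id : ∀ {m k} (Rs : Fin m → RoleSet) (p : Rel k) (ts : Vec Term k) →
         DisjointUnion Rs → ⊢ tabulate (λ i → Rs i ⟨ atom p ts ⟩)
    weaken : ∀ {Γ φ} → ⊢ Γ → ⊢ Γ ,, φ
    contract : ∀ {Γ φ} → ⊢ Γ ,, φ ,, φ → ⊢ Γ ,, φ
    negR : ∀ {Γ R f A} → ⊢ Γ ,, (f ⁻¹[ R ]) ⟨ A ⟩ → ⊢ Γ ,, R ⟨ ¬[ f ] A ⟩
    ∧-neg-l : ∀ {Γ R U A B} → ¬ (U ∋ R) → ⊢ Γ ,, R ⟨ A ⟩ → ⊢ Γ ,, R ⟨ A ∧[ U ] B ⟩
    ∧-neg-r : ∀ {Γ R U A B} → ¬ (U ∋ R) → ⊢ Γ ,, R ⟨ B ⟩ → ⊢ Γ ,, R ⟨ A ∧[ U ] B ⟩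
    ∧-pos : ∀ {Γ R U A B} → U ∋ R → ⊢ Γ ,, R ⟨ A ⟩ → ⊢ Γ ,, R ⟨ B ⟩ →
            ⊢ Γ ,, R ⟨ A ∧[ U ] B ⟩
    ∀-neg : ∀ {Γ R U A} (t : Term) → ¬ (U ∋ R) → ⊢ Γ ,, R ⟨ A [ t ] ⟩ →
            ⊢ Γ ,, R ⟨ ∀[ U ] A ⟩
    -- eigenvariable condition (x not free in Γ) in de Bruijn form:
    -- Γ is shifted so that the fresh variable 0 does not occur in it.
    ∀-pos : ∀ {Γ R U A} → U ∋ R → ⊢ ↑S Γ ,, R ⟨ A ⟩ → ⊢ Γ ,, R ⟨ ∀[ U ] A ⟩

  concatSeq : ∀ {n} → (Fin n → Sequent) → Sequent
  concatSeq Γs = Data.List.concat (tabulate Γs)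

{-# OPTIONS --safe #-}
-- Cut elimination by induction on the size of the cut formula A.
-- For A = ¬_f B every premise is inverted, and the cut moves to B with role sets f⁻¹(R_i).
-- For A = B ∧_U C or ∀_U B, at most one R_k lies outside the ultrafilter U, since two complements
-- in U would meet; the other premises are inverted, ∧ and ∀ being invertible on role sets in U.
-- The derivation of the k-th premise is followed upwards to the rules introducing A, and each is
-- replaced by a cut on an immediate subformula against the inverted premises, followed by
-- contraction of the duplicated contexts.
-- Atomic cuts are reduced premise by premise down to Id axioms; the role sets these axioms assign
-- to formulas other than the cut formula together partition Ω again, forming one Id axiom.
module Submission where

open import Defs
open import Data.Nat using (ℕ; zero; suc; _+_; _≤_; z≤n; s≤s)
open import Data.Nat.Properties
  using (+-suc; +-identityʳ; m+n≡0⇒m≡0; m+n≡0⇒n≡0; n≤0⇒n≡0; suc-injective; ≤-refl; ≤-trans; ≤-reflexive; m≤m+n; m≤n+m)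
open import Data.Nat.ListAction using (sum)
open import Data.Nat.ListAction.Properties using (sum-++; sum-↭)
open import Data.Bool using (Bool; true; false; not)
open import Data.Bool.Properties using (not-injective)
open import Data.Empty using (⊥; ⊥-elim)
open import Data.Fin as Fin using (Fin)
import Data.Fin.Properties as Fin
open import Data.Vec using (Vec; []; _∷_)
open import Data.List using (List; []; _∷_; _++_; map; tabulate; lookup; length)
open import Data.List.Properties using (map-++; map-∘; map-tabulate; tabulate-lookup; length-map; ++-assoc; ++-identityʳ)
open import Data.List.Membership.Propositional using (_∈_; find)
open import Data.List.Membership.Propositional.Properties using (∈-∃++; ∈-lookup; ∈-++⁻; ∈-++⁺ʳ)
open import Data.List.Relation.Unary.Any using (Any; here; there)
open import Data.List.Relation.Unary.All as All using (All; []; _∷_)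
import Data.List.Relation.Unary.All.Properties as All
open import Data.List.Relation.Binary.Pointwise as Pointwise using (Pointwise; []; _∷_)
open import Data.List.Relation.Binary.Permutation.Propositional as ↭
  using (_↭_; ↭-refl; ↭-sym; ↭-trans; ↭-reflexive; prep; swap)
open import Data.List.Relation.Binary.Permutation.Propositional.Properties
  using (map⁺; ++⁺ˡ; ++⁺ʳ; ++-comm; shift; shifts; drop-∷; ∷↭∷ʳ; All-resp-↭; ∈-resp-↭)
open import Data.Product using (_×_; _,_; proj₁; proj₂; ∃)
open import Data.Sum using (_⊎_; inj₁; inj₂)
open import Function using (_∘_)
open import Relation.Nullary using (¬_)
open import Relation.Binary.PropositionalEquality
  using (_≡_; _≢_; _≗_; refl; sym; trans; cong; cong₂; subst; subst₂; module ≡-Reasoning)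

module Syntax (Ω : Set) (Fun Rel : ℕ → Set) where
  open MRL Ω Fun Rel

  ↑ : Subst
  ↑ x = var (suc x)

  inst : Term → Subst
  inst t zero    = t
  inst t (suc x) = var x

  _⊙_ : Subst → Subst → Subst
  (σ ⊙ τ) x = substT σ (τ x)

  mutual
    substT-cong : ∀ {σ τ} → σ ≗ τ → ∀ t → substT σ t ≡ substT τ t
    substT-cong σ≗τ (var x)    = σ≗τ x
    substT-cong σ≗τ (fun g ts) = cong (fun g) (substTs-cong σ≗τ ts)

    substTs-cong : ∀ {σ τ k} → σ ≗ τ → (ts : Vec Term k) → substTs σ ts ≡ substTs τ ts
    substTs-cong σ≗τ []       = refl
    substTs-cong σ≗τ (t ∷ ts) = cong₂ _∷_ (substT-cong σ≗τ t) (substTs-cong σ≗τ ts)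

  mutual
    substT-⊙ : ∀ σ τ t → substT σ (substT τ t) ≡ substT (σ ⊙ τ) t
    substT-⊙ σ τ (var x)    = refl
    substT-⊙ σ τ (fun g ts) = cong (fun g) (substTs-⊙ σ τ ts)

    substTs-⊙ : ∀ {k} σ τ (ts : Vec Term k) → substTs σ (substTs τ ts) ≡ substTs (σ ⊙ τ) ts
    substTs-⊙ σ τ []       = refl
    substTs-⊙ σ τ (t ∷ ts) = cong₂ _∷_ (substT-⊙ σ τ t) (substTs-⊙ σ τ ts)

  mutual
    substT-var : ∀ t → substT var t ≡ t
    substT-var (var x)    = refl
    substT-var (fun g ts) = cong (fun g) (substTs-var ts)

    substTs-var : ∀ {k} (ts : Vec Term k) → substTs var ts ≡ ts
    substTs-var []       = refl
    substTs-var (t ∷ ts) = cong₂ _∷_ (substT-var t) (substTs-var ts)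

  exts-cong : ∀ {σ τ} → σ ≗ τ → exts σ ≗ exts τ
  exts-cong σ≗τ zero    = refl
  exts-cong σ≗τ (suc x) = cong ↑T (σ≗τ x)

  exts-⊙ : ∀ σ τ → exts σ ⊙ exts τ ≗ exts (σ ⊙ τ)
  exts-⊙ σ τ zero    = refl
  exts-⊙ σ τ (suc x) = trans (substT-⊙ (exts σ) ↑ (τ x)) (sym (substT-⊙ ↑ σ (τ x)))

  exts-var : exts var ≗ var
  exts-var zero    = refl
  exts-var (suc x) = refl

  substF-cong : ∀ {σ τ} → σ ≗ τ → ∀ A → substF σ A ≡ substF τ A
  substF-cong σ≗τ (atom p ts)  = cong (atom p) (substTs-cong σ≗τ ts)
  substF-cong σ≗τ (¬[ f ] A)   = cong (¬[ f ]_) (substF-cong σ≗τ A)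
  substF-cong σ≗τ (A ∧[ U ] B) = cong₂ (_∧[ U ]_) (substF-cong σ≗τ A) (substF-cong σ≗τ B)
  substF-cong σ≗τ (∀[ U ] A)   = cong (∀[ U ]_) (substF-cong (exts-cong σ≗τ) A)

  substF-⊙ : ∀ σ τ A → substF σ (substF τ A) ≡ substF (σ ⊙ τ) A
  substF-⊙ σ τ (atom p ts)  = cong (atom p) (substTs-⊙ σ τ ts)
  substF-⊙ σ τ (¬[ f ] A)   = cong (¬[ f ]_) (substF-⊙ σ τ A)
  substF-⊙ σ τ (A ∧[ U ] B) = cong₂ (_∧[ U ]_) (substF-⊙ σ τ A) (substF-⊙ σ τ B)
  substF-⊙ σ τ (∀[ U ] A)   =
    cong (∀[ U ]_) (trans (substF-⊙ (exts σ) (exts τ) A) (substF-cong (exts-⊙ σ τ) A))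

  substF-var : ∀ A → substF var A ≡ A
  substF-var (atom p ts)  = cong (atom p) (substTs-var ts)
  substF-var (¬[ f ] A)   = cong (¬[ f ]_) (substF-var A)
  substF-var (A ∧[ U ] B) = cong₂ (_∧[ U ]_) (substF-var A) (substF-var B)
  substF-var (∀[ U ] A)   = cong (∀[ U ]_) (trans (substF-cong exts-var A) (substF-var A))

  substF-inst : ∀ t A → substF (inst t) A ≡ A [ t ]
  substF-inst t A = substF-cong (λ { zero → refl ; (suc x) → refl }) A

  substF-exts-↑ : ∀ σ A → substF (exts σ) (substF ↑ A) ≡ substF ↑ (substF σ A)
  substF-exts-↑ σ A =
    trans (substF-⊙ (exts σ) ↑ A) (trans (substF-cong (λ _ → refl) A) (sym (substF-⊙ ↑ σ A)))

  substF-[] : ∀ σ A t → substF σ (A [ t ]) ≡ substF (exts σ) A [ substT σ t ]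
  substF-[] σ A t = begin
    substF σ (A [ t ])                             ≡⟨ cong (substF σ) (substF-inst t A) ⟨
    substF σ (substF (inst t) A)                   ≡⟨ substF-⊙ σ (inst t) A ⟩
    substF (σ ⊙ inst t) A                          ≡⟨ substF-cong commute A ⟩
    substF (inst (substT σ t) ⊙ exts σ) A          ≡⟨ substF-⊙ (inst (substT σ t)) (exts σ) A ⟨
    substF (inst (substT σ t)) (substF (exts σ) A) ≡⟨ substF-inst (substT σ t) _ ⟩
    substF (exts σ) A [ substT σ t ]               ∎
    where
    open ≡-Reasoning
    commute : σ ⊙ inst t ≗ inst (substT σ t) ⊙ exts σ
    commute zero    = refl
    commute (suc x) = sym (trans (substT-⊙ (inst (substT σ t)) ↑ (σ x)) (substT-var (σ x)))

  substF-shift-cancel : ∀ σ → (∀ x → σ (suc x) ≡ var x) → ∀ A → substF σ (substF ↑ A) ≡ A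
  substF-shift-cancel σ σ∘suc≗var A = trans (substF-⊙ σ ↑ A) (trans (substF-cong σ∘suc≗var A) (substF-var A))

  fsize : Formula → ℕ
  fsize (atom p ts)  = 1
  fsize (¬[ f ] A)   = suc (fsize A)
  fsize (A ∧[ U ] B) = suc (fsize A + fsize B)
  fsize (∀[ U ] A)   = suc (fsize A)

  fsize-substF : ∀ σ A → fsize (substF σ A) ≡ fsize A
  fsize-substF σ (atom p ts)  = refl
  fsize-substF σ (¬[ f ] A)   = cong suc (fsize-substF σ A)
  fsize-substF σ (A ∧[ U ] B) = cong₂ (λ m n → suc (m + n)) (fsize-substF σ A) (fsize-substF σ B)
  fsize-substF σ (∀[ U ] A)   = cong suc (fsize-substF (exts σ) A)

  fsize-[] : ∀ A t → fsize (A [ t ]) ≡ fsize A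
  fsize-[] A t = trans (cong fsize (sym (substF-inst t A))) (fsize-substF (inst t) A)

  SameUF-refl : ∀ U → SameUF U U
  SameUF-refl U R = (λ u → u) , (λ u → u)

  SameUF-trans : ∀ {U V W} → SameUF U V → SameUF V W → SameUF U W
  SameUF-trans U≈V V≈W R = proj₁ (V≈W R) ∘ proj₁ (U≈V R) , proj₂ (U≈V R) ∘ proj₂ (V≈W R)

  ≈F-refl : ∀ A → A ≈F A
  ≈F-refl (atom p ts)  = atom
  ≈F-refl (¬[ f ] A)   = neg (λ _ → refl) (≈F-refl A)
  ≈F-refl (A ∧[ U ] B) = conj (SameUF-refl U) (≈F-refl A) (≈F-refl B)
  ≈F-refl (∀[ U ] A)   = all (SameUF-refl U) (≈F-refl A)

  ≈F-trans : ∀ {A B C} → A ≈F B → B ≈F C → A ≈F C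
  ≈F-trans atom atom = atom
  ≈F-trans (neg f≗g A≈B) (neg g≗h B≈C) = neg (λ r → trans (f≗g r) (g≗h r)) (≈F-trans A≈B B≈C)
  ≈F-trans (conj {U = U} {V} U≈V A≈B A≈B′) (conj {V = W} V≈W B≈C B≈C′) =
    conj (SameUF-trans {U} {V} {W} U≈V V≈W) (≈F-trans A≈B B≈C) (≈F-trans A≈B′ B≈C′)
  ≈F-trans (all {U = U} {V} U≈V A≈B) (all {V = W} V≈W B≈C) =
    all (SameUF-trans {U} {V} {W} U≈V V≈W) (≈F-trans A≈B B≈C)

  ≈I-refl : ∀ φ → φ ≈I φ
  ≈I-refl (R ⟨ A ⟩) = (λ _ → refl) , ≈F-refl A

  ≈I-trans : ∀ {φ ψ χ} → φ ≈I ψ → ψ ≈I χ → φ ≈I χ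
  ≈I-trans {_ ⟨ _ ⟩} {_ ⟨ _ ⟩} {_ ⟨ _ ⟩} (R≗S , A≈B) (S≗T , B≈C) =
    (λ r → trans (R≗S r) (S≗T r)) , ≈F-trans A≈B B≈C

  substF-≈ : ∀ σ {A B} → A ≈F B → substF σ A ≈F substF σ B
  substF-≈ σ atom              = atom
  substF-≈ σ (neg f≗g A≈B)     = neg f≗g (substF-≈ σ A≈B)
  substF-≈ σ (conj U≈V A≈B C≈D) = conj U≈V (substF-≈ σ A≈B) (substF-≈ σ C≈D)
  substF-≈ σ (all U≈V A≈B)     = all U≈V (substF-≈ (exts σ) A≈B)

  []-≈ : ∀ {A B} t → A ≈F B → (A [ t ]) ≈F (B [ t ])
  []-≈ {A} {B} t A≈B = subst₂ _≈F_ (substF-inst t A) (substF-inst t B) (substF-≈ (inst t) A≈B)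

  substI : Subst → IFormula → IFormula
  substI σ (R ⟨ A ⟩) = R ⟨ substF σ A ⟩

  substS : Subst → Sequent → Sequent
  substS σ = map (substI σ)

  substI-≈ : ∀ σ {φ ψ} → φ ≈I ψ → substI σ φ ≈I substI σ ψ
  substI-≈ σ {_ ⟨ _ ⟩} {_ ⟨ _ ⟩} (R≗S , A≈B) = R≗S , substF-≈ σ A≈B

  substS-,, : ∀ σ Γ φ → substS σ (Γ ,, φ) ≡ substS σ Γ ,, substI σ φ
  substS-,, σ Γ φ = map-++ (substI σ) Γ (φ ∷ [])

  ↑S≡substS : ∀ Γ → ↑S Γ ≡ substS ↑ Γ
  ↑S≡substS []              = refl
  ↑S≡substS ((R ⟨ A ⟩) ∷ Γ) = cong (_ ∷_) (↑S≡substS Γ)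

  ↑S-++ : ∀ Γ Δ → ↑S (Γ ++ Δ) ≡ ↑S Γ ++ ↑S Δ
  ↑S-++ []      Δ = refl
  ↑S-++ (φ ∷ Γ) Δ = cong (↑I φ ∷_) (↑S-++ Γ Δ)

  substS-exts-↑S : ∀ σ Γ → substS (exts σ) (↑S Γ) ≡ ↑S (substS σ Γ)
  substS-exts-↑S σ []              = refl
  substS-exts-↑S σ ((R ⟨ A ⟩) ∷ Γ) = cong₂ _∷_ (cong (R ⟨_⟩) (substF-exts-↑ σ A)) (substS-exts-↑S σ Γ)

  substS-↑S-cancel : ∀ σ → (∀ x → σ (suc x) ≡ var x) → ∀ Γ → substS σ (↑S Γ) ≡ Γ
  substS-↑S-cancel σ σ∘suc≗var []              = refl
  substS-↑S-cancel σ σ∘suc≗var ((R ⟨ A ⟩) ∷ Γ) =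
    cong₂ _∷_ (cong (R ⟨_⟩) (substF-shift-cancel σ σ∘suc≗var A)) (substS-↑S-cancel σ σ∘suc≗var Γ)

module Sequents (Ω : Set) (Fun Rel : ℕ → Set) where
  open MRL Ω Fun Rel
  open Syntax Ω Fun Rel

  ∈⇒↭∷ : ∀ {a} {A : Set a} {x : A} {xs} → x ∈ xs → ∃ λ ys → xs ↭ x ∷ ys
  ∈⇒↭∷ x∈xs with ∈-∃++ x∈xs
  ... | ys , zs , refl = ys ++ zs , shift _ ys zs

  ,,-↭-∷ : ∀ {Γ Δ} φ → Γ ↭ Δ → Γ ,, φ ↭ φ ∷ Δ
  ,,-↭-∷ {Γ} φ Γ↭Δ = ↭-trans (↭-sym (∷↭∷ʳ φ Γ)) (prep φ Γ↭Δ)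

  ↑S-↭ : ∀ {Γ Δ} → Γ ↭ Δ → ↑S Γ ↭ ↑S Δ
  ↑S-↭ {Γ} {Δ} Γ↭Δ = subst₂ _↭_ (sym (↑S≡substS Γ)) (sym (↑S≡substS Δ)) (map⁺ (substI ↑) Γ↭Δ)

  data Position (Γ₀ : Sequent) (φ : IFormula) (Γ M : Sequent) : Set₁ where
    inContext : ∀ Γ₁ → Γ ↭ φ ∷ Γ₁ → Γ₀ ↭ Γ₁ ++ M → Position Γ₀ φ Γ M
    inCopies  : ∀ M₁ → M ↭ φ ∷ M₁ → Γ₀ ↭ Γ ++ M₁ → Position Γ₀ φ Γ M

  locate : ∀ {Γ₀ φ} Γ M → Γ₀ ,, φ ↭ Γ ++ M → Position Γ₀ φ Γ M
  locate {Γ₀} {φ} Γ M q with ∈-++⁻ Γ (∈-resp-↭ q (∈-++⁺ʳ Γ₀ (here refl)))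
  ... | inj₁ φ∈Γ = let Γ₁ , Γ↭ = ∈⇒↭∷ φ∈Γ in
    inContext Γ₁ Γ↭ (drop-∷ (↭-trans (∷↭∷ʳ φ Γ₀) (↭-trans q (++⁺ʳ M Γ↭))))
  ... | inj₂ φ∈M = let M₁ , M↭ = ∈⇒↭∷ φ∈M in
    inCopies M₁ M↭ (drop-∷ (↭-trans (∷↭∷ʳ φ Γ₀) (↭-trans q (↭-trans (++⁺ˡ Γ M↭) (shift φ Γ M₁)))))

  _≈S_ : Sequent → Sequent → Set₁
  _≈S_ = Pointwise _≈I_

  ≈S-refl : ∀ {Γ} → Γ ≈S Γ
  ≈S-refl = Pointwise.refl (≈I-refl _)

  ≈S-↭ : ∀ {Γ Δ Θ} → Γ ≈S Δ → Δ ↭ Θ → ∃ λ Γ′ → Γ ↭ Γ′ × Γ′ ≈S Θ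
  ≈S-↭ Γ≈Δ ↭.refl = _ , ↭-refl , Γ≈Δ
  ≈S-↭ (φ≈ψ ∷ Γ≈Δ) (prep _ p) =
    let _ , q , Γ′≈ = ≈S-↭ Γ≈Δ p in _ , prep _ q , φ≈ψ ∷ Γ′≈
  ≈S-↭ (φ≈ψ ∷ φ′≈ψ′ ∷ Γ≈Δ) (swap _ _ p) =
    let _ , q , Γ′≈ = ≈S-↭ Γ≈Δ p in _ , swap _ _ q , φ′≈ψ′ ∷ φ≈ψ ∷ Γ′≈
  ≈S-↭ Γ≈Δ (↭.trans p p′) =
    let _ , q , Γ′≈ = ≈S-↭ Γ≈Δ p ; _ , q′ , Γ″≈ = ≈S-↭ Γ′≈ p′ in _ , ↭-trans q q′ , Γ″≈

  ≈S-++⁻ : ∀ {Θ} Γ Δ → Θ ≈S (Γ ++ Δ) → ∃ λ Γ′ → ∃ λ Δ′ → Θ ≡ Γ′ ++ Δ′ × Γ′ ≈S Γ × Δ′ ≈S Δ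
  ≈S-++⁻ []      Δ Θ≈           = [] , _ , refl , [] , Θ≈
  ≈S-++⁻ (φ ∷ Γ) Δ (ψ≈φ ∷ Θ≈) with ≈S-++⁻ Γ Δ Θ≈
  ... | Γ′ , Δ′ , refl , Γ′≈ , Δ′≈ = _ ∷ Γ′ , Δ′ , refl , ψ≈φ ∷ Γ′≈ , Δ′≈

module Derivations (Ω : Set) (Fun Rel : ℕ → Set) where
  open MRL Ω Fun Rel
  open Syntax Ω Fun Rel

  private
    ⊢-substS-,, : ∀ σ Γ φ → ⊢ substS σ (Γ ,, φ) → ⊢ substS σ Γ ,, substI σ φ
    ⊢-substS-,, σ Γ φ = subst ⊢_ (substS-,, σ Γ φ)

    ⊢-,,-substS : ∀ σ Γ φ → ⊢ substS σ Γ ,, substI σ φ → ⊢ substS σ (Γ ,, φ)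
    ⊢-,,-substS σ Γ φ = subst ⊢_ (sym (substS-,, σ Γ φ))

  ⊢-subst : ∀ σ {Γ} → ⊢ Γ → ⊢ substS σ Γ
  ⊢-subst σ (exch p d)        = exch (map⁺ (substI σ) p) (⊢-subst σ d)
  ⊢-subst σ (conv Γ≈Δ d)      = conv (Pointwise.map⁺ _ _ (Pointwise.map (substI-≈ σ) Γ≈Δ)) (⊢-subst σ d)
  ⊢-subst σ (Id Rs p ts du)   =
    subst ⊢_ (sym (map-tabulate (λ i → Rs i ⟨ atom p ts ⟩) (substI σ))) (Id Rs p (substTs σ ts) du)
  ⊢-subst σ (weaken {Γ} d)    = ⊢-,,-substS σ Γ _ (weaken (⊢-subst σ d))
  ⊢-subst σ (contract {Γ} {φ} d) =
    ⊢-,,-substS σ Γ φ (contract (subst ⊢_ (cong (_,, substI σ φ) (substS-,, σ Γ φ))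
                                  (⊢-substS-,, σ (Γ ,, φ) φ (⊢-subst σ d))))
  ⊢-subst σ (negR {Γ} d)      = ⊢-,,-substS σ Γ _ (negR (⊢-substS-,, σ Γ _ (⊢-subst σ d)))
  ⊢-subst σ (∧-neg-l {Γ} u d) = ⊢-,,-substS σ Γ _ (∧-neg-l u (⊢-substS-,, σ Γ _ (⊢-subst σ d)))
  ⊢-subst σ (∧-neg-r {Γ} u d) = ⊢-,,-substS σ Γ _ (∧-neg-r u (⊢-substS-,, σ Γ _ (⊢-subst σ d)))
  ⊢-subst σ (∧-pos {Γ} u d e) =
    ⊢-,,-substS σ Γ _ (∧-pos u (⊢-substS-,, σ Γ _ (⊢-subst σ d)) (⊢-substS-,, σ Γ _ (⊢-subst σ e)))
  ⊢-subst σ (∀-neg {Γ} {R} {A = A} t u d) =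
    ⊢-,,-substS σ Γ _ (∀-neg (substT σ t) u
      (subst (λ B → ⊢ substS σ Γ ,, R ⟨ B ⟩) (substF-[] σ A t) (⊢-substS-,, σ Γ _ (⊢-subst σ d))))
  ⊢-subst σ (∀-pos {Γ} u d)   =
    ⊢-,,-substS σ Γ _ (∀-pos u
      (subst (λ Δ → ⊢ Δ ,, _) (substS-exts-↑S σ Γ) (⊢-substS-,, (exts σ) (↑S Γ) _ (⊢-subst (exts σ) d))))

  ⊢-↑S : ∀ {Γ} → ⊢ Γ → ⊢ ↑S Γ
  ⊢-↑S {Γ} d = subst ⊢_ (sym (↑S≡substS Γ)) (⊢-subst ↑ d)

  ⊢-inst : ∀ t {ψ} Γ → ⊢ ψ ∷ ↑S Γ → ⊢ substI (inst t) ψ ∷ Γ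
  ⊢-inst t Γ d = subst (λ Δ → ⊢ _ ∷ Δ) (substS-↑S-cancel (inst t) (λ _ → refl) Γ) (⊢-subst (inst t) d)

  ⊢-rotate : ∀ {φ Γ} → ⊢ φ ∷ Γ → ⊢ Γ ,, φ
  ⊢-rotate {φ} {Γ} = exch (∷↭∷ʳ φ Γ)

  ⊢-unrotate : ∀ {φ Γ} → ⊢ Γ ,, φ → ⊢ φ ∷ Γ
  ⊢-unrotate {φ} {Γ} = exch (↭-sym (∷↭∷ʳ φ Γ))

  ⊢-at-head : ∀ {ψ φ} → (∀ {Γ} → ⊢ Γ ,, ψ → ⊢ Γ ,, φ) → ∀ {Γ} → ⊢ ψ ∷ Γ → ⊢ φ ∷ Γ
  ⊢-at-head rule = ⊢-unrotate ∘ rule ∘ ⊢-rotate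

  ⊢-weaken-∷ : ∀ {φ Γ} → ⊢ Γ → ⊢ φ ∷ Γ
  ⊢-weaken-∷ = ⊢-unrotate ∘ weaken

  ⊢-contract-∷ : ∀ {φ Γ} → ⊢ φ ∷ φ ∷ Γ → ⊢ φ ∷ Γ
  ⊢-contract-∷ {φ} {Γ} = ⊢-unrotate ∘ contract ∘ exch (↭-trans (∷↭∷ʳ φ (φ ∷ Γ)) (++⁺ʳ (φ ∷ []) (∷↭∷ʳ φ Γ)))

  ⊢-absorb : ∀ {ψ φ Γ} → ψ ≈I φ → ⊢ (ψ ∷ Γ) ,, φ → ⊢ Γ ,, φ
  ⊢-absorb ψ≈φ d = contract (⊢-rotate (conv (ψ≈φ ∷ ≈S-refl) d))
    where open Sequents Ω Fun Rel using (≈S-refl)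

  ⊢-weaken-++ : ∀ Γ Δ → ⊢ Γ → ⊢ Γ ++ Δ
  ⊢-weaken-++ Γ []      d = subst ⊢_ (sym (++-identityʳ Γ)) d
  ⊢-weaken-++ Γ (φ ∷ Δ) d = subst ⊢_ (++-assoc Γ (φ ∷ []) Δ) (⊢-weaken-++ (Γ ,, φ) Δ (weaken d))

  private
    ⊢-contract-++ˡ : ∀ Δ Γ → ⊢ Δ ++ Δ ++ Γ → ⊢ Δ ++ Γ
    ⊢-contract-++ˡ []      Γ d = d
    ⊢-contract-++ˡ (φ ∷ Δ) Γ d =
      exch (shift φ Δ Γ)
        (⊢-contract-++ˡ Δ (φ ∷ Γ) (exch φ-last (⊢-contract-∷ (exch (prep φ (shift φ Δ (Δ ++ Γ))) d))))
      where
      φ-last : φ ∷ Δ ++ Δ ++ Γ ↭ Δ ++ Δ ++ φ ∷ Γ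
      φ-last = ↭-trans (↭-sym (shift φ Δ (Δ ++ Γ))) (++⁺ˡ Δ (↭-sym (shift φ Δ Γ)))

  ⊢-contract-++ : ∀ Γ Δ → ⊢ (Γ ++ Δ) ++ Δ → ⊢ Γ ++ Δ
  ⊢-contract-++ Γ Δ d =
    exch (++-comm Δ Γ) (⊢-contract-++ˡ Δ Γ (exch (↭-trans (++-comm (Γ ++ Δ) Δ) (++⁺ˡ Δ (++-comm Γ Δ))) d))

module ExactCovers (Ω : Set) where

  bit : Bool → ℕ
  bit false = 0
  bit true  = 1

  multiplicity : Ω → List (Ω → Bool) → ℕ
  multiplicity r Ss = sum (map (λ S → bit (S r)) Ss)

  Partitions : List (Ω → Bool) → (Ω → Bool) → Set
  Partitions Ss S = ∀ r → multiplicity r Ss ≡ bit (S r)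

  ExactCover : List (Ω → Bool) → Set
  ExactCover Ss = Partitions Ss (λ _ → true)

  multiplicity-++ : ∀ r Ss Ts → multiplicity r (Ss ++ Ts) ≡ multiplicity r Ss + multiplicity r Ts
  multiplicity-++ r Ss Ts = trans (cong sum (map-++ _ Ss Ts)) (sum-++ (map _ Ss) _)

  Partitions-↭ : ∀ {Ss Ts S} → Ss ↭ Ts → Partitions Ss S → Partitions Ts S
  Partitions-↭ Ss↭Ts Ss⊢S r = trans (sym (sum-↭ (map⁺ _ Ss↭Ts))) (Ss⊢S r)

  Partitions-refine : ∀ Ts Us {S V} → Partitions Ts S → Partitions (S ∷ Us) V → Partitions (Ts ++ Us) V
  Partitions-refine Ts Us Ts⊢S S∷Us⊢V r =
    trans (multiplicity-++ r Ts Us) (trans (cong (_+ multiplicity r Us) (Ts⊢S r)) (S∷Us⊢V r))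

  ExactCover-preimage : ∀ (f : Ω → Ω) {Ss} → ExactCover Ss → ExactCover (map (λ S r → S (f r)) Ss)
  ExactCover-preimage f {Ss} cover r = trans (cong sum (sym (map-∘ Ss))) (cover (f r))

  multiplicity-false : ∀ {r} Ss → All (λ S → S r ≡ false) Ss → multiplicity r Ss ≡ 0
  multiplicity-false []       []          = refl
  multiplicity-false (S ∷ Ss) (Sr≡f ∷ rest) rewrite Sr≡f = multiplicity-false Ss rest

  multiplicity≡0⇒∉ : ∀ {r S Ss} → multiplicity r Ss ≡ 0 → S ∈ Ss → S r ≡ false
  multiplicity≡0⇒∉ {r} {S} m≡0 (here refl) with S r
  ... | false = refl
  multiplicity≡0⇒∉ {r} {Ss = T ∷ _} m≡0 (there S∈Ss) = multiplicity≡0⇒∉ (m+n≡0⇒n≡0 (bit (T r)) m≡0) S∈Ss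

  ExactCover-∷-disjoint : ∀ {S Ss} → ExactCover (S ∷ Ss) → All (λ T → ∀ r → S r ≡ true → T r ≡ false) Ss
  ExactCover-∷-disjoint cover =
    All.tabulate λ T∈Ss r Sr → multiplicity≡0⇒∉ (suc-injective (subst (λ b → bit b + _ ≡ 1) Sr (cover r))) T∈Ss

  Partitions-complement : ∀ {S : Ω → Bool} Ts S′ Ss → All (λ T → ∀ r → T r ≡ S r) (S′ ∷ Ss) →
                          ExactCover (Ts ++ S′ ∷ Ss) → Partitions Ts (λ r → not (S r))
  Partitions-complement {S} Ts S′ Ss copies cover r
    with S r | All.map (λ T≗S → T≗S r) copies | trans (sym (multiplicity-++ r Ts (S′ ∷ Ss))) (cover r)
  ... | true  | S′r ∷ _ | m≡1 =
    m+n≡0⇒m≡0 _ (suc-injective (trans (sym (+-suc _ _)) (subst (λ b → multiplicity r Ts + (bit b + _) ≡ 1) S′r m≡1)))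
  ... | false | copies-r | m≡1 =
    trans (sym (+-identityʳ _)) (trans (cong (multiplicity r Ts +_) (sym (multiplicity-false (S′ ∷ Ss) copies-r))) m≡1)

module DisjointUnions (Ω : Set) (Fun Rel : ℕ → Set) where
  open MRL Ω Fun Rel
  open ExactCovers Ω

  private
    multiplicity-tabulate : ∀ {m} (Rs : Fin m → RoleSet) r i → Rs i r ≡ true → (∀ j → Rs j r ≡ true → j ≡ i) →
                            multiplicity r (tabulate Rs) ≡ 1
    multiplicity-tabulate Rs r Fin.zero Rs0r unique rewrite Rs0r =
      cong suc (multiplicity-false _ (All.tabulate⁺ others-miss))
      where
      others-miss : ∀ j → Rs (Fin.suc j) r ≡ false
      others-miss j with Rs (Fin.suc j) r in Rsjr
      ... | false = refl
      ... | true with unique (Fin.suc j) Rsjr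
      ...   | ()
    multiplicity-tabulate Rs r (Fin.suc i) Rsir unique with Rs Fin.zero r in Rs0r
    ... | true with unique Fin.zero Rs0r
    ...   | ()
    multiplicity-tabulate Rs r (Fin.suc i) Rsir unique | false =
      multiplicity-tabulate (Rs ∘ Fin.suc) r i Rsir (λ j Rsjr → Fin.suc-injective (unique (Fin.suc j) Rsjr))

    lookup-∃ : ∀ Ss r → multiplicity r Ss ≡ 1 → ∃ λ i → lookup Ss i r ≡ true
    lookup-∃ (S ∷ Ss) r m≡1 with S r in Sr
    ... | true  = Fin.zero , Sr
    ... | false = let i , Sir = lookup-∃ Ss r m≡1 in Fin.suc i , Sir

    others-miss : ∀ {S Ss r} → S r ≡ true → multiplicity r (S ∷ Ss) ≤ 1 → ∀ i → lookup Ss i r ≢ true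
    others-miss {S} {Ss} {r} Sr m≤1 i Sir with subst (λ b → bit b + multiplicity r Ss ≤ 1) Sr m≤1
    ... | s≤s m≤0 with trans (sym Sir) (multiplicity≡0⇒∉ {r} {Ss = Ss} (n≤0⇒n≡0 m≤0) (∈-lookup i))
    ...   | ()

    lookup-unique : ∀ Ss r → multiplicity r Ss ≤ 1 → ∀ i j → lookup Ss i r ≡ true → lookup Ss j r ≡ true → i ≡ j
    lookup-unique (S ∷ Ss) r m≤1 Fin.zero    Fin.zero    _   _   = refl
    lookup-unique (S ∷ Ss) r m≤1 Fin.zero    (Fin.suc j) Sr  Sjr = ⊥-elim (others-miss {S} {Ss} Sr m≤1 j Sjr)
    lookup-unique (S ∷ Ss) r m≤1 (Fin.suc i) Fin.zero    Sir Sr  = ⊥-elim (others-miss {S} {Ss} Sr m≤1 i Sir)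
    lookup-unique (S ∷ Ss) r m≤1 (Fin.suc i) (Fin.suc j) Sir Sjr =
      cong Fin.suc (lookup-unique Ss r (≤-trans (m≤n+m _ (bit (S r))) m≤1) i j Sir Sjr)

  disjointUnion⇒exactCover : ∀ {m} (Rs : Fin m → RoleSet) → DisjointUnion Rs → ExactCover (tabulate Rs)
  disjointUnion⇒exactCover Rs (unique , covered) r =
    let i , Rsir = covered r in multiplicity-tabulate Rs r i Rsir (λ j Rsjr → unique j i r Rsjr Rsir)

  exactCover⇒disjointUnion : ∀ Ss → ExactCover Ss → DisjointUnion (lookup Ss)
  exactCover⇒disjointUnion Ss cover =
    (λ i j r → lookup-unique Ss r (≤-reflexive (cover r)) i j) , (λ r → lookup-∃ Ss r (cover r))

module Reduction (Ω : Set) (Fun Rel : ℕ → Set) where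
  open MRL Ω Fun Rel
  open Syntax Ω Fun Rel
  open Sequents Ω Fun Rel
  open Derivations Ω Fun Rel

  AtomOf : ∀ {k} → Rel k → Vec Term k → IFormula → Set₁
  AtomOf p ts φ = ∃ λ S → φ ≡ S ⟨ atom p ts ⟩

  Id-atoms : ∀ {m k} (Rs : Fin m → RoleSet) (p : Rel k) ts → All (AtomOf p ts) (tabulate (λ i → Rs i ⟨ atom p ts ⟩))
  Id-atoms Rs p ts = All.tabulate⁺ (λ i → Rs i , refl)

  Id-copy⇒atom : ∀ {m k} (Rs : Fin m → RoleSet) {p : Rel k} {ts} Γ {φ M R A} →
                 tabulate (λ i → Rs i ⟨ atom p ts ⟩) ↭ Γ ++ φ ∷ M → φ ≈I (R ⟨ A ⟩) → A ≡ atom p ts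
  Id-copy⇒atom Rs {p} {ts} Γ q φ≈ with All.head (All.++⁻ʳ Γ (All-resp-↭ q (Id-atoms Rs p ts)))
  ... | _ , refl with φ≈
  ...   | _ , atom = refl

  -- A derivation of Δ ↭ Γ ++ M, where M holds copies of R ⟨ cutFormula e ⟩ (several after
  -- contractions), is turned into one of Γ ++ output e by following it upwards. Only the rules
  -- introducing a copy need a specific argument; passing an eigenvariable shifts e.
  module Reduce {E : Set₁} (shiftE : E → E) (cutFormula : E → Formula) (output : E → Sequent)
                (output-shift : ∀ e → output (shiftE e) ≡ ↑S (output e))
                (cutFormula-shift : ∀ e → cutFormula (shiftE e) ≡ substF ↑ (cutFormula e))
                (R : RoleSet) where

    Copy : E → IFormula → Set₁
    Copy e φ = φ ≈I (R ⟨ cutFormula e ⟩)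

    record PrincipalCases : Set₁ where
      field
        on-Id      : ∀ e {k} {p : Rel k} {ts} → cutFormula e ≡ atom p ts →
                     ∀ Γ φ M {m} (Rs : Fin m → RoleSet) → DisjointUnion Rs →
                     tabulate (λ i → Rs i ⟨ atom p ts ⟩) ↭ Γ ++ φ ∷ M → All (Copy e) (φ ∷ M) → ⊢ Γ ++ output e
        on-¬       : ∀ e Γ {R′ f A′} → Copy e (R′ ⟨ ¬[ f ] A′ ⟩) →
                     ⊢ ((f ⁻¹[ R′ ]) ⟨ A′ ⟩ ∷ Γ) ++ output e → ⊢ Γ ++ output e
        on-∧-neg-l : ∀ e Γ {R′ U A′ B′} → Copy e (R′ ⟨ A′ ∧[ U ] B′ ⟩) → ¬ (U ∋ R′) →
                     ⊢ (R′ ⟨ A′ ⟩ ∷ Γ) ++ output e → ⊢ Γ ++ output e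
        on-∧-neg-r : ∀ e Γ {R′ U A′ B′} → Copy e (R′ ⟨ A′ ∧[ U ] B′ ⟩) → ¬ (U ∋ R′) →
                     ⊢ (R′ ⟨ B′ ⟩ ∷ Γ) ++ output e → ⊢ Γ ++ output e
        on-∧-pos   : ∀ e Γ {R′ U A′ B′} → Copy e (R′ ⟨ A′ ∧[ U ] B′ ⟩) → U ∋ R′ →
                     ⊢ (R′ ⟨ A′ ⟩ ∷ Γ) ++ output e → ⊢ (R′ ⟨ B′ ⟩ ∷ Γ) ++ output e → ⊢ Γ ++ output e
        on-∀-neg   : ∀ e Γ {R′ U A′} → Copy e (R′ ⟨ ∀[ U ] A′ ⟩) → ¬ (U ∋ R′) → ∀ t →
                     ⊢ (R′ ⟨ A′ [ t ] ⟩ ∷ Γ) ++ output e → ⊢ Γ ++ output e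
        on-∀-pos   : ∀ e Γ {R′ U A′} → Copy e (R′ ⟨ ∀[ U ] A′ ⟩) → U ∋ R′ →
                     (∀ t → ⊢ (R′ ⟨ A′ [ t ] ⟩ ∷ Γ) ++ output e) → ⊢ Γ ++ output e

    private
      Copy-↑S : ∀ e M → All (Copy e) M → All (Copy (shiftE e)) (↑S M)
      Copy-↑S e []              []       = []
      Copy-↑S e ((S ⟨ A ⟩) ∷ M) (c ∷ cs) =
        subst (λ B → (S ⟨ substF ↑ A ⟩) ≈I (R ⟨ B ⟩)) (sym (cutFormula-shift e))
              (substI-≈ ↑ {S ⟨ A ⟩} {R ⟨ cutFormula e ⟩} c)
        ∷ Copy-↑S e M cs

      Copy-≈S : ∀ {e Γ Δ} → Γ ≈S Δ → All (Copy e) Δ → All (Copy e) Γ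
      Copy-≈S []          []       = []
      Copy-≈S (φ≈ψ ∷ Γ≈Δ) (c ∷ cs) = ≈I-trans φ≈ψ c ∷ Copy-≈S Γ≈Δ cs

      back : ∀ e {Γ Γ₁ φ} → Γ ↭ φ ∷ Γ₁ → ⊢ (φ ∷ Γ₁) ++ output e → ⊢ Γ ++ output e
      back e Γ↭ = exch (++⁺ʳ (output e) (↭-sym Γ↭))

      ↑S-output : ∀ e Γ → ↑S Γ ++ output (shiftE e) ≡ ↑S (Γ ++ output e)
      ↑S-output e Γ = trans (cong (↑S Γ ++_) (output-shift e)) (sym (↑S-++ Γ (output e)))

      instantiate : ∀ e Γ {R′ A′} → ⊢ (R′ ⟨ A′ ⟩ ∷ ↑S Γ) ++ output (shiftE e) →
                    ∀ t → ⊢ (R′ ⟨ A′ [ t ] ⟩ ∷ Γ) ++ output e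
      instantiate e Γ {R′} {A′} d t =
        subst (λ B → ⊢ R′ ⟨ B ⟩ ∷ Γ ++ output e) (substF-inst t A′)
              (⊢-inst t (Γ ++ output e) (subst (λ Δ → ⊢ _ ∷ Δ) (↑S-output e Γ) d))

    module _ (cases : PrincipalCases) where
      open PrincipalCases cases

      private
        unary : ∀ {e Γ₀ ψ φ Γ M} → (∀ {Δ} → ⊢ Δ ,, ψ → ⊢ Δ ,, φ) →
                (∀ Γ → Copy e φ → ⊢ (ψ ∷ Γ) ++ output e → ⊢ Γ ++ output e) →
                (∀ Γ M → Γ₀ ,, ψ ↭ Γ ++ M → All (Copy e) M → ⊢ Γ ++ output e) →
                Γ₀ ,, φ ↭ Γ ++ M → All (Copy e) M → ⊢ Γ ++ output e
        unary {e} {Γ = Γ} {M} rule principal ih q copies with locate Γ M q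
        ... | inContext Γ₁ Γ↭ q′ = back e Γ↭ (⊢-at-head rule (ih (_ ∷ Γ₁) M (,,-↭-∷ _ q′) copies))
        ... | inCopies M₁ M↭ q′ with All-resp-↭ M↭ copies
        ...   | c ∷ cs = principal Γ c (ih (_ ∷ Γ) M₁ (,,-↭-∷ _ q′) cs)

        eigen : ∀ {e Γ₀ U R′ A′ Γ M} → U ∋ R′ →
                (∀ Γ M → Γ₀ ↭ Γ ++ M → All (Copy e) M → ⊢ (R′ ⟨ A′ ⟩ ∷ ↑S Γ) ++ output (shiftE e)) →
                Γ₀ ,, R′ ⟨ ∀[ U ] A′ ⟩ ↭ Γ ++ M → All (Copy e) M → ⊢ Γ ++ output e
        eigen {e} {Γ = Γ} {M} u ih q copies with locate Γ M q
        ... | inContext Γ₁ Γ↭ q′ =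
          back e Γ↭ (⊢-unrotate (∀-pos u (⊢-rotate (subst (λ Δ → ⊢ _ ∷ Δ) (↑S-output e Γ₁) (ih Γ₁ M q′ copies)))))
        ... | inCopies M₁ M↭ q′ with All-resp-↭ M↭ copies
        ...   | c ∷ cs = on-∀-pos e Γ c u (instantiate e Γ (ih Γ M₁ q′ cs))

      reduce : ∀ {Δ} → ⊢ Δ → ∀ e Γ M → Δ ↭ Γ ++ M → All (Copy e) M → ⊢ Γ ++ output e
      reduce (exch p d) e Γ M q copies = reduce d e Γ M (↭-trans p q) copies
      reduce (conv Δ≈ d) e Γ M q copies with ≈S-↭ Δ≈ q
      ... | _ , q′ , Θ≈ with ≈S-++⁻ Γ M Θ≈
      ...   | Γ′ , M′ , refl , Γ′≈Γ , M′≈M =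
        conv (Pointwise.++⁺ Γ′≈Γ ≈S-refl) (reduce d e Γ′ M′ q′ (Copy-≈S M′≈M copies))
      reduce (Id Rs p ts du) e Γ [] q [] =
        ⊢-weaken-++ Γ (output e) (exch (↭-trans q (↭-reflexive (++-identityʳ Γ))) (Id Rs p ts du))
      reduce (Id Rs p ts du) e Γ (φ ∷ M) q copies@(c ∷ _) =
        on-Id e (Id-copy⇒atom Rs Γ q c) Γ φ M Rs du q copies
      reduce (weaken d) e Γ M q copies with locate Γ M q
      ... | inContext Γ₁ Γ↭ q′ = back e Γ↭ (⊢-weaken-∷ (reduce d e Γ₁ M q′ copies))
      ... | inCopies M₁ M↭ q′ = reduce d e Γ M₁ q′ (All.tail (All-resp-↭ M↭ copies))
      reduce (contract {φ = φ} d) e Γ M q copies with locate Γ M q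
      ... | inContext Γ₁ Γ↭ q′ =
        back e Γ↭ (⊢-contract-∷ (reduce d e (φ ∷ φ ∷ Γ₁) M (,,-↭-∷ φ (,,-↭-∷ φ q′)) copies))
      ... | inCopies M₁ M↭ q′ with All-resp-↭ M↭ copies
      ...   | c ∷ cs =
        reduce d e Γ (φ ∷ φ ∷ M₁) (↭-trans (,,-↭-∷ φ (,,-↭-∷ φ q′)) (shifts (φ ∷ φ ∷ []) Γ)) (c ∷ c ∷ cs)
      reduce (negR d) e Γ M q copies = unary negR (λ Γ → on-¬ e Γ) (reduce d e) q copies
      reduce (∧-neg-l u d) e Γ M q copies = unary (∧-neg-l u) (λ Γ c → on-∧-neg-l e Γ c u) (reduce d e) q copies
      reduce (∧-neg-r u d) e Γ M q copies = unary (∧-neg-r u) (λ Γ c → on-∧-neg-r e Γ c u) (reduce d e) q copies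
      reduce (∀-neg t u d) e Γ M q copies = unary (∀-neg t u) (λ Γ c → on-∀-neg e Γ c u t) (reduce d e) q copies
      reduce (∧-pos u d d′) e Γ M q copies with locate Γ M q
      ... | inContext Γ₁ Γ↭ q′ =
        back e Γ↭ (⊢-unrotate (∧-pos u (⊢-rotate (reduce d e (_ ∷ Γ₁) M (,,-↭-∷ _ q′) copies))
                                        (⊢-rotate (reduce d′ e (_ ∷ Γ₁) M (,,-↭-∷ _ q′) copies))))
      ... | inCopies M₁ M↭ q′ with All-resp-↭ M↭ copies
      ...   | c ∷ cs =
        on-∧-pos e Γ c u (reduce d e (_ ∷ Γ) M₁ (,,-↭-∷ _ q′) cs) (reduce d′ e (_ ∷ Γ) M₁ (,,-↭-∷ _ q′) cs)
      reduce (∀-pos {Γ₀} u d) e Γ M q copies = eigen u ih↑ q copies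
        where
        ih↑ : ∀ Γ M → Γ₀ ↭ Γ ++ M → All (Copy e) M → ⊢ (_ ∷ ↑S Γ) ++ output (shiftE e)
        ih↑ Γ M q copies =
          reduce d (shiftE e) (_ ∷ ↑S Γ) (↑S M) (,,-↭-∷ _ (subst (↑S Γ₀ ↭_) (↑S-++ Γ M) (↑S-↭ q)))
                 (Copy-↑S e M copies)

module Inversion (Ω : Set) (Fun Rel : ℕ → Set) where
  open MRL Ω Fun Rel
  open Syntax Ω Fun Rel
  open Derivations Ω Fun Rel
  open Reduction Ω Fun Rel

  ∋-resp-≗ : ∀ U {R S} → U ∋ R → (∀ r → S r ≡ R r) → U ∋ S
  ∋-resp-≗ U u S≗R = IsFilter.upward (Ultrafilter.isFilter U) (λ r Rr → trans (S≗R r) Rr) u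

  private
    ∉-contradiction : ∀ U V {R S} → U ∋ R → ¬ (V ∋ S) → SameUF V U → (∀ r → S r ≡ R r) → ⊥
    ∉-contradiction U V u S∉V V≈U S≗R = S∉V (∋-resp-≗ V (proj₂ (V≈U _) u) S≗R)

  ¬-inversion : ∀ {Γ R f A} → ⊢ Γ ,, R ⟨ ¬[ f ] A ⟩ → ⊢ Γ ,, (f ⁻¹[ R ]) ⟨ A ⟩
  ¬-inversion {Γ} {R} {f} {A} d = reduce cases d A Γ (_ ∷ []) ↭-refl (≈I-refl _ ∷ [])
    where
    open Reduce (substF ↑) (¬[ f ]_) (λ B → (f ⁻¹[ R ]) ⟨ B ⟩ ∷ []) (λ _ → refl) (λ _ → refl) R
    cases : PrincipalCases
    cases = record
      { on-Id      = λ _ ()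
      ; on-¬       = λ { _ _ {f = f′} (R′≗R , neg f′≗f A′≈B) →
                         ⊢-absorb ((λ r → trans (R′≗R (f′ r)) (cong R (f′≗f r))) , A′≈B) }
      ; on-∧-neg-l = λ { _ _ (_ , ()) }
      ; on-∧-neg-r = λ { _ _ (_ , ()) }
      ; on-∧-pos   = λ { _ _ (_ , ()) }
      ; on-∀-neg   = λ { _ _ (_ , ()) }
      ; on-∀-pos   = λ { _ _ (_ , ()) }
      }

  data Conjunct : Set where
    first second : Conjunct

  conjunct : Conjunct → Formula → Formula → Formula
  conjunct first  A B = A
  conjunct second A B = B

  conjunct-substF : ∀ s σ A B → conjunct s (substF σ A) (substF σ B) ≡ substF σ (conjunct s A B)
  conjunct-substF first  σ A B = refl
  conjunct-substF second σ A B = refl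

  ∧-inversion : ∀ s {Γ R U A B} → U ∋ R → ⊢ Γ ,, R ⟨ A ∧[ U ] B ⟩ → ⊢ Γ ,, R ⟨ conjunct s A B ⟩
  ∧-inversion s {Γ} {R} {U} {A} {B} u d = reduce cases d (A , B) Γ (_ ∷ []) ↭-refl (≈I-refl _ ∷ [])
    where
    shiftE : Formula × Formula → Formula × Formula
    shiftE (A , B) = substF ↑ A , substF ↑ B
    output : Formula × Formula → Sequent
    output (A , B) = R ⟨ conjunct s A B ⟩ ∷ []
    output-shift : ∀ e → output (shiftE e) ≡ ↑S (output e)
    output-shift (A , B) = cong (λ C → R ⟨ C ⟩ ∷ []) (conjunct-substF s ↑ A B)
    open Reduce shiftE (λ (A , B) → A ∧[ U ] B) output output-shift (λ _ → refl) R
    principal : ∀ s {Γ R′ A′ B′ C D} → (∀ r → R′ r ≡ R r) → A′ ≈F C → B′ ≈F D →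
                ⊢ (R′ ⟨ A′ ⟩ ∷ Γ) ,, R ⟨ conjunct s C D ⟩ → ⊢ (R′ ⟨ B′ ⟩ ∷ Γ) ,, R ⟨ conjunct s C D ⟩ →
                ⊢ Γ ,, R ⟨ conjunct s C D ⟩
    principal first  R′≗R A′≈C B′≈D dA dB = ⊢-absorb (R′≗R , A′≈C) dA
    principal second R′≗R A′≈C B′≈D dA dB = ⊢-absorb (R′≗R , B′≈D) dB
    cases : PrincipalCases
    cases = record
      { on-Id      = λ _ ()
      ; on-¬       = λ { _ _ (_ , ()) }
      ; on-∧-neg-l = λ { _ _ {U = V} (R′≗R , conj V≈U _ _) R′∉V _ →
                         ⊥-elim (∉-contradiction U V u R′∉V V≈U R′≗R) }
      ; on-∧-neg-r = λ { _ _ {U = V} (R′≗R , conj V≈U _ _) R′∉V _ →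
                         ⊥-elim (∉-contradiction U V u R′∉V V≈U R′≗R) }
      ; on-∧-pos   = λ { _ _ (R′≗R , conj _ A′≈C B′≈D) _ → principal s R′≗R A′≈C B′≈D }
      ; on-∀-neg   = λ { _ _ (_ , ()) }
      ; on-∀-pos   = λ { _ _ (_ , ()) }
      }

  ∀-inversion : ∀ {Γ R U A} t → U ∋ R → ⊢ Γ ,, R ⟨ ∀[ U ] A ⟩ → ⊢ Γ ,, R ⟨ A [ t ] ⟩
  ∀-inversion {Γ} {R} {U} {A} t u d = reduce cases d (A , t) Γ (_ ∷ []) ↭-refl (≈I-refl _ ∷ [])
    where
    shiftE : Formula × Term → Formula × Term
    shiftE (B , s) = substF (exts ↑) B , substT ↑ s
    output : Formula × Term → Sequent
    output (B , s) = R ⟨ B [ s ] ⟩ ∷ []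
    output-shift : ∀ e → output (shiftE e) ≡ ↑S (output e)
    output-shift (B , s) = cong (λ C → R ⟨ C ⟩ ∷ []) (sym (substF-[] ↑ B s))
    open Reduce shiftE (λ (B , _) → ∀[ U ] B) output output-shift (λ _ → refl) R
    cases : PrincipalCases
    cases = record
      { on-Id      = λ _ ()
      ; on-¬       = λ { _ _ (_ , ()) }
      ; on-∧-neg-l = λ { _ _ (_ , ()) }
      ; on-∧-neg-r = λ { _ _ (_ , ()) }
      ; on-∧-pos   = λ { _ _ (_ , ()) }
      ; on-∀-neg   = λ { _ _ {U = V} (R′≗R , all V≈U _) R′∉V _ _ →
                         ⊥-elim (∉-contradiction U V u R′∉V V≈U R′≗R) }
      ; on-∀-pos   = λ { (_ , s) _ (R′≗R , all _ A′≈B) _ d → ⊢-absorb (R′≗R , []-≈ s A′≈B) (d s) }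
      }

module CutPremises (Ω : Set) (Fun Rel : ℕ → Set) where
  open MRL Ω Fun Rel
  open Syntax Ω Fun Rel
  open Sequents Ω Fun Rel
  open Derivations Ω Fun Rel
  open ExactCovers Ω
  open Inversion Ω Fun Rel

  CutPremise : Set₁
  CutPremise = Sequent × RoleSet

  Proves : Formula → CutPremise → Set₁
  Proves A (Γ , R) = ⊢ Γ ,, R ⟨ A ⟩

  contexts : List CutPremise → Sequent
  contexts []            = []
  contexts ((Γ , _) ∷ Ps) = Γ ++ contexts Ps

  coRoles : List CutPremise → List RoleSet
  coRoles = map (∁ ∘ proj₂)

  contexts-tabulate : ∀ {n} (Γs : Fin n → Sequent) (Rs : Fin n → RoleSet) →
                      contexts (tabulate (λ i → Γs i , Rs i)) ≡ concatSeq Γs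
  contexts-tabulate {zero}  Γs Rs = refl
  contexts-tabulate {suc n} Γs Rs = cong (Γs Fin.zero ++_) (contexts-tabulate (Γs ∘ Fin.suc) (Rs ∘ Fin.suc))

  contexts-↭ : ∀ {Ps Qs} → Ps ↭ Qs → contexts Ps ↭ contexts Qs
  contexts-↭ ↭.refl                    = ↭-refl
  contexts-↭ (prep (Γ , _) p)          = ++⁺ˡ Γ (contexts-↭ p)
  contexts-↭ (swap (Γ , _) (Δ , _) p)  = ↭-trans (shifts Γ Δ) (++⁺ˡ Δ (++⁺ˡ Γ (contexts-↭ p)))
  contexts-↭ (↭.trans p q)             = ↭-trans (contexts-↭ p) (contexts-↭ q)

  shiftPremise : CutPremise → CutPremise
  shiftPremise (Γ , R) = ↑S Γ , R

  Proves-↑ : ∀ {A P} → Proves A P → Proves (substF ↑ A) (shiftPremise P)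
  Proves-↑ {P = Γ , _} d = subst ⊢_ (↑S-++ Γ _) (⊢-↑S d)

  contexts-↑ : ∀ Ps → contexts (map shiftPremise Ps) ≡ ↑S (contexts Ps)
  contexts-↑ []             = refl
  contexts-↑ ((Γ , _) ∷ Ps) = trans (cong (↑S Γ ++_) (contexts-↑ Ps)) (sym (↑S-++ Γ (contexts Ps)))

  coRoles-↑ : ∀ Ps → coRoles (map shiftPremise Ps) ≡ coRoles Ps
  coRoles-↑ []       = refl
  coRoles-↑ (_ ∷ Ps) = cong (_ ∷_) (coRoles-↑ Ps)

  preimagePremise : (Ω → Ω) → CutPremise → CutPremise
  preimagePremise f (Γ , R) = Γ , f ⁻¹[ R ]

  contexts-preimage : ∀ f Ps → contexts (map (preimagePremise f) Ps) ≡ contexts Ps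
  contexts-preimage f []             = refl
  contexts-preimage f ((Γ , _) ∷ Ps) = cong (Γ ++_) (contexts-preimage f Ps)

  ExactCover-¬ : ∀ f Ps → ExactCover (coRoles Ps) → ExactCover (coRoles (map (preimagePremise f) Ps))
  ExactCover-¬ f Ps cover = subst ExactCover (sym (coRoles-preimage Ps)) (ExactCover-preimage f {coRoles Ps} cover)
    where
    coRoles-preimage : ∀ Ps → coRoles (map (preimagePremise f) Ps) ≡ map (λ S r → S (f r)) (coRoles Ps)
    coRoles-preimage []       = refl
    coRoles-preimage (_ ∷ Ps) = cong (_ ∷_) (coRoles-preimage Ps)

  ¬-invert : ∀ {f A Ps} → All (Proves (¬[ f ] A)) Ps → All (Proves A) (map (preimagePremise f) Ps)
  ¬-invert = All.map⁺ ∘ All.map ¬-inversion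

  record Positives (U : Ultrafilter) (Rk : RoleSet) (A : Formula) : Set₁ where
    constructor positives
    field
      premises : List CutPremise
      proofs   : All (Proves A) premises
      inU      : All ((U ∋_) ∘ proj₂) premises
      cover    : ExactCover (∁ Rk ∷ coRoles premises)

  Positives-↑ : ∀ {U Rk A} → Positives U Rk A → Positives U Rk (substF ↑ A)
  Positives-↑ {Rk = Rk} (positives Ps ds us cover) =
    positives (map shiftPremise Ps) (All.map⁺ (All.map Proves-↑ ds)) (All.map⁺ us)
              (subst (λ Ss → ExactCover (∁ Rk ∷ Ss)) (sym (coRoles-↑ Ps)) cover)

  ∧-invert : ∀ s {U Rk A B} (pos : Positives U Rk (A ∧[ U ] B)) →
             All (Proves (conjunct s A B)) (Positives.premises pos)
  ∧-invert s (positives _ ds us _) = All.zipWith (λ (d , u) → ∧-inversion s u d) (ds , us)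

  ∀-invert : ∀ t {U Rk A} (pos : Positives U Rk (∀[ U ] A)) → All (Proves (A [ t ])) (Positives.premises pos)
  ∀-invert t (positives _ ds us _) = All.zipWith (λ (d , u) → ∀-inversion t u d) (ds , us)

  record KeySplit (U : Ultrafilter) (A : Formula) (Ps : List CutPremise) : Set₁ where
    constructor keySplit
    field
      keyContext : Sequent
      keyRoles   : RoleSet
      keyProof   : ⊢ keyContext ,, keyRoles ⟨ A ⟩
      others     : Positives U keyRoles A
      contexts↭  : contexts Ps ↭ keyContext ++ contexts (Positives.premises others)

  private
    inU-or-key : ∀ U (Ps : List CutPremise) → All ((U ∋_) ∘ proj₂) Ps ⊎ Any ((U ∋_) ∘ ∁ ∘ proj₂) Ps
    inU-or-key U []       = inj₁ []
    inU-or-key U (P ∷ Ps) with Ultrafilter.ultra U (proj₂ P) | inU-or-key U Ps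
    ... | inj₂ ∁R∈U | _       = inj₂ (here ∁R∈U)
    ... | inj₁ R∈U  | inj₁ us = inj₁ (R∈U ∷ us)
    ... | inj₁ _    | inj₂ k  = inj₂ (there k)

    -- The complements are disjoint, so the complement of the key role set lies inside every other R_i.
    splitAt : ∀ U {A} Ps → ExactCover (coRoles Ps) → All (Proves A) Ps → Any ((U ∋_) ∘ ∁ ∘ proj₂) Ps →
              KeySplit U A Ps
    splitAt U Ps cover ds key with find key
    ... | (Γk , Rk) , key∈Ps , ∁Rk∈U with ∈⇒↭∷ key∈Ps
    ...   | Os , Ps↭ with All-resp-↭ Ps↭ ds
    ...     | dk ∷ dOs = keySplit Γk Rk dk (positives Os dOs inU cover′) (contexts-↭ Ps↭)
      where
      cover′ : ExactCover (∁ Rk ∷ coRoles Os)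
      cover′ = Partitions-↭ (map⁺ (∁ ∘ proj₂) Ps↭) cover
      inU : All ((U ∋_) ∘ proj₂) Os
      inU = All.map (λ disjoint → IsFilter.upward (Ultrafilter.isFilter U)
                                    (λ r r∉Rk → not-injective {y = true} (disjoint r r∉Rk)) ∁Rk∈U)
                    (All.map⁻ (ExactCover-∷-disjoint cover′))

  splitKey : ∀ U {A} Ps → Ps ≢ [] → ExactCover (coRoles Ps) → All (Proves A) Ps → KeySplit U A Ps
  splitKey U []       Ps≢[] _     _        = ⊥-elim (Ps≢[] refl)
  splitKey U (P ∷ Ps) _     cover (d ∷ ds) with inU-or-key U (P ∷ Ps)
  ... | inj₁ (_ ∷ us) = keySplit (proj₁ P) (proj₂ P) d (positives Ps ds us cover) ↭-refl
  ... | inj₂ key      = splitAt U (P ∷ Ps) cover (d ∷ ds) key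

module AtomicCut (Ω : Set) (Fun Rel : ℕ → Set) where
  open MRL Ω Fun Rel
  open Syntax Ω Fun Rel
  open Derivations Ω Fun Rel
  open ExactCovers Ω
  open DisjointUnions Ω Fun Rel
  open Reduction Ω Fun Rel
  open CutPremises Ω Fun Rel

  atoms : ∀ {k} → Rel k → Vec Term k → List RoleSet → Sequent
  atoms p ts = map (λ S → S ⟨ atom p ts ⟩)

  atoms-↑ : ∀ {k} (p : Rel k) ts Ts → atoms p (substTs ↑ ts) Ts ≡ ↑S (atoms p ts Ts)
  atoms-↑ p ts []       = refl
  atoms-↑ p ts (_ ∷ Ts) = cong (_ ∷_) (atoms-↑ p ts Ts)

  ⊢-atoms : ∀ {k} (p : Rel k) ts Ts → ExactCover Ts → ⊢ atoms p ts Ts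
  ⊢-atoms p ts Ts cover = subst ⊢_ Id≡atoms (Id (lookup Ts) p ts (exactCover⇒disjointUnion Ts cover))
    where
    Id≡atoms : tabulate (λ i → lookup Ts i ⟨ atom p ts ⟩) ≡ atoms p ts Ts
    Id≡atoms = trans (sym (map-tabulate (lookup Ts) _)) (cong (atoms p ts) (tabulate-lookup Ts))

  role : IFormula → RoleSet
  role (S ⟨ _ ⟩) = S

  private
    role-≈ : ∀ {ψ R A} → ψ ≈I (R ⟨ A ⟩) → ∀ r → role ψ r ≡ R r
    role-≈ {_ ⟨ _ ⟩} = proj₁

    atoms-role : ∀ {k} {p : Rel k} {ts} Γ → All (AtomOf p ts) Γ → Γ ≡ atoms p ts (map role Γ)
    atoms-role []      []                = refl
    atoms-role (_ ∷ Γ) ((_ , refl) ∷ Γ-atoms) = cong (_ ∷_) (atoms-role Γ Γ-atoms)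

  Id-leaf : ∀ {m k} (Rs : Fin m → RoleSet) {p : Rel k} {ts} Γ {φ M Rk} → DisjointUnion Rs →
            tabulate (λ i → Rs i ⟨ atom p ts ⟩) ↭ Γ ++ φ ∷ M → All (λ ψ → ψ ≈I (Rk ⟨ atom p ts ⟩)) (φ ∷ M) →
            ∃ λ T → Γ ≡ atoms p ts T × Partitions T (∁ Rk)
  Id-leaf Rs {p} {ts} Γ {φ} {M} du q copies =
    map role Γ ,
    atoms-role Γ (All.++⁻ˡ Γ (All-resp-↭ q (Id-atoms Rs p ts))) ,
    Partitions-complement (map role Γ) (role φ) (map role M) (All.map⁺ (All.map role-≈ copies)) cover
    where
    roles↭ : tabulate Rs ↭ map role Γ ++ role φ ∷ map role M
    roles↭ = subst₂ _↭_ (map-tabulate _ role) (map-++ role Γ (φ ∷ M)) (map⁺ role q)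
    cover : ExactCover (map role Γ ++ role φ ∷ map role M)
    cover = Partitions-↭ roles↭ (disjointUnion⇒exactCover Rs du)

  -- leaves collects the role sets of the Id axioms reached in the premises already reduced.
  record AtomicState {k} (p : Rel k) (n : ℕ) (Rk : RoleSet) : Set₁ where
    constructor atomicState
    field
      terms    : Vec Term k
      leaves   : List RoleSet
      pending  : List CutPremise
      #pending : length pending ≡ n
      proofs   : All (Proves (atom p terms)) pending
      cover    : ExactCover (∁ Rk ∷ leaves ++ coRoles pending)

  module _ {k} (p : Rel k) (n : ℕ) (Rk : RoleSet) where

    AtomicState-↑ : AtomicState p n Rk → AtomicState p n Rk
    AtomicState-↑ (atomicState ts Ts Ps #Ps ds cover) =
      atomicState (substTs ↑ ts) Ts (map shiftPremise Ps) (trans (length-map _ Ps) #Ps)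
                  (All.map⁺ (All.map Proves-↑ ds))
                  (subst (λ Ss → ExactCover (∁ Rk ∷ Ts ++ Ss)) (sym (coRoles-↑ Ps)) cover)

    atomicOutput : AtomicState p n Rk → Sequent
    atomicOutput s = atoms p (AtomicState.terms s) (AtomicState.leaves s) ++ contexts (AtomicState.pending s)

    atomicOutput-↑ : ∀ s → atomicOutput (AtomicState-↑ s) ≡ ↑S (atomicOutput s)
    atomicOutput-↑ (atomicState ts Ts Ps _ _ _) =
      trans (cong₂ _++_ (atoms-↑ p ts Ts) (contexts-↑ Ps)) (sym (↑S-++ (atoms p ts Ts) (contexts Ps)))

  atomic-cut : ∀ n {k} (p : Rel k) ts Ts Ps → length Ps ≡ n → All (Proves (atom p ts)) Ps →
               ExactCover (Ts ++ coRoles Ps) → ⊢ atoms p ts Ts ++ contexts Ps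
  atomic-cut zero p ts Ts [] _ [] cover =
    subst ⊢_ (sym (++-identityʳ _)) (⊢-atoms p ts Ts (subst ExactCover (++-identityʳ Ts) cover))
  atomic-cut (suc n) p ts Ts ((Γ , Rk) ∷ Ps) #Ps (d ∷ ds) cover =
    exch (shifts Γ (atoms p ts Ts)) (reduce cases d state Γ (_ ∷ []) ↭-refl (≈I-refl _ ∷ []))
    where
    open Reduce (AtomicState-↑ p n Rk) (λ s → atom p (AtomicState.terms s)) (atomicOutput p n Rk)
                (atomicOutput-↑ p n Rk) (λ _ → refl) Rk
    state : AtomicState p n Rk
    state = atomicState ts Ts Ps (suc-injective #Ps) ds (Partitions-↭ (shift (∁ Rk) Ts (coRoles Ps)) cover)
    leaf : ∀ s Γ φ M {m} (Rs : Fin m → RoleSet) → DisjointUnion Rs →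
           tabulate (λ i → Rs i ⟨ atom p (AtomicState.terms s) ⟩) ↭ Γ ++ φ ∷ M → All (Copy s) (φ ∷ M) →
           ⊢ Γ ++ atomicOutput p n Rk s
    leaf (atomicState ts′ Ts′ Ps′ #Ps′ ds′ cover′) Γ φ M Rs du q copies with Id-leaf Rs Γ du q copies
    ... | T , refl , T⊢∁Rk =
      subst ⊢_ (trans (cong (_++ contexts Ps′) (map-++ _ T Ts′)) (++-assoc (atoms p ts′ T) _ _))
        (atomic-cut n p ts′ (T ++ Ts′) Ps′ #Ps′ ds′
          (subst ExactCover (sym (++-assoc T Ts′ _)) (Partitions-refine T (Ts′ ++ coRoles Ps′) T⊢∁Rk cover′)))
    cases : PrincipalCases
    cases = record
      { on-Id      = λ { s refl → leaf s }
      ; on-¬       = λ { _ _ (_ , ()) }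
      ; on-∧-neg-l = λ { _ _ (_ , ()) }
      ; on-∧-neg-r = λ { _ _ (_ , ()) }
      ; on-∧-pos   = λ { _ _ (_ , ()) }
      ; on-∀-neg   = λ { _ _ (_ , ()) }
      ; on-∀-pos   = λ { _ _ (_ , ()) }
      }

module PrincipalCut (Ω : Set) (Fun Rel : ℕ → Set) where
  open MRL Ω Fun Rel
  open Syntax Ω Fun Rel
  open Sequents Ω Fun Rel
  open Derivations Ω Fun Rel
  open ExactCovers Ω
  open Reduction Ω Fun Rel
  open Inversion Ω Fun Rel
  open CutPremises Ω Fun Rel
  open AtomicCut Ω Fun Rel

  fsize-substF-≤ : ∀ σ {A k} → fsize A ≤ k → fsize (substF σ A) ≤ k
  fsize-substF-≤ σ {A} = subst (_≤ _) (sym (fsize-substF σ A))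

  record ∧-State (U : Ultrafilter) (k : ℕ) (Rk : RoleSet) : Set₁ where
    constructor ∧-state
    field
      lhs rhs : Formula
      lhs≤    : fsize lhs ≤ k
      rhs≤    : fsize rhs ≤ k
      others  : Positives U Rk (lhs ∧[ U ] rhs)

  ∧-State-↑ : ∀ {U k Rk} → ∧-State U k Rk → ∧-State U k Rk
  ∧-State-↑ (∧-state A B A≤ B≤ others) =
    ∧-state (substF ↑ A) (substF ↑ B) (fsize-substF-≤ ↑ A≤) (fsize-substF-≤ ↑ B≤) (Positives-↑ others)

  record ∀-State (U : Ultrafilter) (k : ℕ) (Rk : RoleSet) : Set₁ where
    constructor ∀-state
    field
      body   : Formula
      body≤  : fsize body ≤ k
      others : Positives U Rk (∀[ U ] body)

  ∀-State-↑ : ∀ {U k Rk} → ∀-State U k Rk → ∀-State U k Rk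
  ∀-State-↑ (∀-state A A≤ others) = ∀-state (substF (exts ↑) A) (fsize-substF-≤ (exts ↑) A≤) (Positives-↑ others)

  conjunct-≤ : ∀ s {A B k} → fsize A ≤ k → fsize B ≤ k → fsize (conjunct s A B) ≤ k
  conjunct-≤ first  A≤ B≤ = A≤
  conjunct-≤ second A≤ B≤ = B≤

  mutual
    mp-cut : ∀ k A → fsize A ≤ k → ∀ Ps → Ps ≢ [] → ExactCover (coRoles Ps) → All (Proves A) Ps → ⊢ contexts Ps
    mp-cut k (atom p ts) _ Ps _ cover ds = atomic-cut (length Ps) p ts [] Ps refl ds cover
    mp-cut (suc k) (¬[ f ] A) (s≤s A≤) Ps Ps≢[] cover ds =
      subst ⊢_ (contexts-preimage f Ps)
        (mp-cut k A A≤ (map (preimagePremise f) Ps) (map-≢[] Ps Ps≢[]) (ExactCover-¬ f Ps cover) (¬-invert ds))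
      where
      map-≢[] : ∀ Ps → Ps ≢ [] → map (preimagePremise f) Ps ≢ []
      map-≢[] []      Ps≢[] = Ps≢[]
      map-≢[] (_ ∷ _) _     = λ ()
    mp-cut (suc k) (A ∧[ U ] B) (s≤s A+B≤) Ps Ps≢[] cover ds with splitKey U Ps Ps≢[] cover ds
    ... | keySplit Γk Rk dk others Ps↭ =
      exch (↭-sym Ps↭)
        (∧-cut-key k (∧-state A B (≤-trans (m≤m+n _ _) A+B≤) (≤-trans (m≤n+m _ _) A+B≤) others) Γk dk)
    mp-cut (suc k) (∀[ U ] A) (s≤s A≤) Ps Ps≢[] cover ds with splitKey U Ps Ps≢[] cover ds
    ... | keySplit Γk Rk dk others Ps↭ = exch (↭-sym Ps↭) (∀-cut-key k (∀-state A A≤ others) Γk dk)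

    -- The key premise's rule introduced the cut formula: cut its immediate subformula against the
    -- inverted other premises, which duplicates their contexts.
    cut-principal : ∀ k {B} → fsize B ≤ k → ∀ {Rk R′ A′} Γ Os → (∀ r → R′ r ≡ Rk r) → A′ ≈F B →
                    ExactCover (∁ Rk ∷ coRoles Os) → All (Proves B) Os →
                    ⊢ (R′ ⟨ A′ ⟩ ∷ Γ) ++ contexts Os → ⊢ Γ ++ contexts Os
    cut-principal k {B} B≤ {Rk} Γ Os R′≗Rk A′≈B cover ds d =
      ⊢-contract-++ Γ (contexts Os) (mp-cut k B B≤ ((Γ ++ contexts Os , Rk) ∷ Os) (λ ()) cover (key ∷ ds))
      where
      key : ⊢ (Γ ++ contexts Os) ,, Rk ⟨ B ⟩
      key = ⊢-rotate (conv ((R′≗Rk , A′≈B) ∷ ≈S-refl) d)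

    ∧-cut-key : ∀ k {U Rk} (s : ∧-State U k Rk) Γ → ⊢ Γ ,, Rk ⟨ ∧-State.lhs s ∧[ U ] ∧-State.rhs s ⟩ →
                ⊢ Γ ++ contexts (Positives.premises (∧-State.others s))
    ∧-cut-key k {U} {Rk} s Γ d = reduce cases d s Γ (_ ∷ []) ↭-refl (≈I-refl _ ∷ [])
      where
      output : ∧-State U k Rk → Sequent
      output s = contexts (Positives.premises (∧-State.others s))
      open Reduce ∧-State-↑ (λ s → ∧-State.lhs s ∧[ U ] ∧-State.rhs s) output
                  (λ s → contexts-↑ (Positives.premises (∧-State.others s))) (λ _ → refl) Rk
      principal : ∀ c s Γ {R′ A′} → (∀ r → R′ r ≡ Rk r) → A′ ≈F conjunct c (∧-State.lhs s) (∧-State.rhs s) →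
                  ⊢ (R′ ⟨ A′ ⟩ ∷ Γ) ++ output s → ⊢ Γ ++ output s
      principal c (∧-state A B A≤ B≤ others) Γ R′≗Rk A′≈ =
        cut-principal k (conjunct-≤ c A≤ B≤) Γ (Positives.premises others) R′≗Rk A′≈
                      (Positives.cover others) (∧-invert c others)
      cases : PrincipalCases
      cases = record
        { on-Id      = λ _ ()
        ; on-¬       = λ { _ _ (_ , ()) }
        ; on-∧-neg-l = λ { s Γ (R′≗Rk , conj _ A′≈A _) _ → principal first s Γ R′≗Rk A′≈A }
        ; on-∧-neg-r = λ { s Γ (R′≗Rk , conj _ _ B′≈B) _ → principal second s Γ R′≗Rk B′≈B }
        ; on-∧-pos   = λ { s Γ (R′≗Rk , conj _ A′≈A _) _ dA _ → principal first s Γ R′≗Rk A′≈A dA }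
        ; on-∀-neg   = λ { _ _ (_ , ()) }
        ; on-∀-pos   = λ { _ _ (_ , ()) }
        }

    ∀-cut-key : ∀ k {U Rk} (s : ∀-State U k Rk) Γ → ⊢ Γ ,, Rk ⟨ ∀[ U ] ∀-State.body s ⟩ →
                ⊢ Γ ++ contexts (Positives.premises (∀-State.others s))
    ∀-cut-key k {U} {Rk} s Γ d = reduce cases d s Γ (_ ∷ []) ↭-refl (≈I-refl _ ∷ [])
      where
      output : ∀-State U k Rk → Sequent
      output s = contexts (Positives.premises (∀-State.others s))
      open Reduce ∀-State-↑ (λ s → ∀[ U ] ∀-State.body s) output
                  (λ s → contexts-↑ (Positives.premises (∀-State.others s))) (λ _ → refl) Rk
      principal : ∀ s Γ t {R′ A′} → (∀ r → R′ r ≡ Rk r) → A′ ≈F ∀-State.body s →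
                  ⊢ (R′ ⟨ A′ [ t ] ⟩ ∷ Γ) ++ output s → ⊢ Γ ++ output s
      principal (∀-state A A≤ others) Γ t R′≗Rk A′≈A =
        cut-principal k (subst (_≤ k) (sym (fsize-[] A t)) A≤) Γ (Positives.premises others) R′≗Rk
                      ([]-≈ t A′≈A) (Positives.cover others) (∀-invert t others)
      cases : PrincipalCases
      cases = record
        { on-Id      = λ _ ()
        ; on-¬       = λ { _ _ (_ , ()) }
        ; on-∧-neg-l = λ { _ _ (_ , ()) }
        ; on-∧-neg-r = λ { _ _ (_ , ()) }
        ; on-∧-pos   = λ { _ _ (_ , ()) }
        ; on-∀-neg   = λ { s Γ (R′≗Rk , all _ A′≈A) _ t → principal s Γ t R′≗Rk A′≈A }
        -- any instance of the eigenvariable premise will do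
        ; on-∀-pos   = λ { s Γ (R′≗Rk , all _ A′≈A) _ d → principal s Γ (var 0) R′≗Rk A′≈A (d (var 0)) }
        }

lemma1 : (Ω : Set) (Fun Rel : ℕ → Set) →
    let open MRL Ω Fun Rel in
    (n : ℕ) → 1 ≤ n →
    (Rs : Fin n → RoleSet) → DisjointUnion (λ i → ∁ (Rs i)) →
    (A : Formula) (Γs : Fin n → Sequent) →
    (∀ i → ⊢ (Γs i ,, Rs i ⟨ A ⟩)) →
    ⊢ concatSeq Γs
lemma1 Ω Fun Rel (suc n) (s≤s z≤n) Rs du A Γs ⊢Γs =
  subst ⊢_ (contexts-tabulate Γs Rs) (mp-cut (fsize A) A ≤-refl Ps (λ ()) cover (All.tabulate⁺ ⊢Γs))
  where
  open MRL Ω Fun Rel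
  open Syntax Ω Fun Rel using (fsize)
  open ExactCovers Ω using (ExactCover)
  open DisjointUnions Ω Fun Rel using (disjointUnion⇒exactCover)
  open CutPremises Ω Fun Rel using (CutPremise; coRoles; contexts-tabulate)
  open PrincipalCut Ω Fun Rel using (mp-cut)
  Ps : List CutPremise
  Ps = tabulate (λ i → Γs i , Rs i)
  cover : ExactCover (coRoles Ps)
  cover = subst ExactCover (sym (map-tabulate (λ i → Γs i , Rs i) (∁ ∘ proj₂)))
                (disjointUnion⇒exactCover (∁ ∘ Rs) du)
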